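{- Let $G=(V,E)$ be a finite directed graph with distinct nodes $s,t$ such that $s$ has in-degree $0$, $t$ has out-degree $0$, every node is reachable from $s$ and every node can reach $t$ by a directed path. For any two vertices $u,v\in V$: (i) $v\in A(u)$ or $u\in A(v)$; and (ii) $v\in B(u)$ or $u\in B(v)$.
   Context: For $u\in V$, $A(u)$ denotes the set of nodes that can be reached from $s$ by a directed path that does not pass through $u$, and $B(u)$ denotes the set of nodes from which $t$ can be reached by a directed path that does not pass through $u$. -}

module Defs where

open import Data.Nat using (ℕ)
open import Data.Fin using (Fin)
open import Data.Bool using (Bool; T)
open import Relation.Binary.PropositionalEquality using (_≢_)

Graph : ℕ → Set
Graph n = Fin n → Fin n → Bool

data Path {n : ℕ} (G : Graph n) : Fin n → Fin n → Set where
  here : ∀ {x} → Path G x x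
  step : ∀ {x y z} → T (G x y) → Path G y z → Path G x z

-- Directed paths from x to y none of whose vertices (endpoints included) is u.
data PathAvoiding {n : ℕ} (G : Graph n) (u : Fin n) : Fin n → Fin n → Set where
  here : ∀ {x} → x ≢ u → PathAvoiding G u x x
  step : ∀ {x y z} → x ≢ u → T (G x y) → PathAvoiding G u y z → PathAvoiding G u x z

A : ∀ {n} → Graph n → (s u : Fin n) → Fin n → Set
A G s u v = PathAvoiding G u s v

B : ∀ {n} → Graph n → (t u : Fin n) → Fin n → Set
B G t u v = PathAvoiding G u v t

{-# OPTIONS --safe #-}
module Submission where

open import Defs
open import Data.Nat using (ℕ)
open import Data.Fin using (Fin; _≟_)
open import Data.Bool using (T)
open import Data.Product using (_×_; _,_)
open import Data.Sum using (_⊎_; inj₁; inj₂; fromInj₁)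
open import Data.Empty using (⊥-elim)
open import Relation.Nullary using (¬_; yes; no)
open import Relation.Binary.PropositionalEquality using (_≢_; refl; ≢-sym)

-- For (i) cut a walk s ⇝ v at its first visit to u or v, for (ii) cut a walk
-- v ⇝ t after its last visit to u or v: the piece between the cut and the
-- far end avoids the other vertex.

source≢avoided : ∀ {n} {G : Graph n} {u x y : Fin n} → PathAvoiding G u x y → x ≢ u
source≢avoided (here x≢u)     = x≢u
source≢avoided (step x≢u _ _) = x≢u

module _ {n : ℕ} {G : Graph n} {u v : Fin n} (u≢v : u ≢ v) where

  avoiding-prefix : ∀ {x} → Path G x v → PathAvoiding G u x v ⊎ PathAvoiding G v x u
  avoiding-prefix here = inj₁ (here (≢-sym u≢v))
  avoiding-prefix {x} (step e p) with x ≟ u | x ≟ v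
  ... | yes refl | _        = inj₂ (here u≢v)
  ... | no _     | yes refl = inj₁ (here (≢-sym u≢v))
  ... | no x≢u   | no x≢v   with avoiding-prefix p
  ...   | inj₁ q = inj₁ (step x≢u e q)
  ...   | inj₂ q = inj₂ (step x≢v e q)

  LastVisit : Fin n → Fin n → Set
  LastVisit x y = (PathAvoiding G u v y ⊎ PathAvoiding G v u y)
                ⊎ (PathAvoiding G u x y × PathAvoiding G v x y)

  enter : ∀ {x y} → (x ≢ u → PathAvoiding G u x y) → (x ≢ v → PathAvoiding G v x y)
        → LastVisit x y
  enter {x} avoid-u avoid-v with x ≟ u | x ≟ v
  ... | yes refl | _        = inj₁ (inj₂ (avoid-v u≢v))
  ... | no _     | yes refl = inj₁ (inj₁ (avoid-u (≢-sym u≢v)))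
  ... | no x≢u   | no x≢v   = inj₂ (avoid-u x≢u , avoid-v x≢v)

  avoiding-suffix : ∀ {x y} → Path G x y → LastVisit x y
  avoiding-suffix here = enter here here
  avoiding-suffix (step e p) with avoiding-suffix p
  ... | inj₁ r       = inj₁ r
  ... | inj₂ (a , b) = enter (λ x≢u → step x≢u e a) (λ x≢v → step x≢v e b)

lemma1 : ∀ {n : ℕ} (G : Graph n) (s t : Fin n) → s ≢ t
       → (∀ x → ¬ T (G x s)) → (∀ y → ¬ T (G t y))
       → (∀ v → Path G s v) → (∀ v → Path G v t)
       → ∀ (u v : Fin n) → u ≢ v
       → (A G s u v ⊎ A G s v u) × (B G t u v ⊎ B G t v u)
lemma1 G s t _ _ _ fromS toT u v u≢v =
  avoiding-prefix u≢v (fromS v) ,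
  fromInj₁ (λ (_ , v⇝t) → ⊥-elim (source≢avoided v⇝t refl))
           (avoiding-suffix u≢v (toT v))
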